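{- Let $N$ be a positive integer divisible by $8$. Then the power series $\theta_{A_1^{N/2}}(q^2)=\vartheta_3(q^2)^{N/2}$ and $\theta_{D_{N/2}^*}(q^2)=\vartheta_3(q^2)^{N/2}+\vartheta_2(q^2)^{N/2}$ (both power series in $q$ with integer exponents) have the same coefficients on all even powers of $q$ when $N\equiv8\pmod{16}$, and the same coefficients on all odd powers of $q$ when $N\equiv0\pmod{16}$.
   Context: $\vartheta_2(q)=\sum_{n\in\mathbb{Z}}q^{(n+\frac12)^2/2}$, $\vartheta_3(q)=\sum_{n\in\mathbb{Z}}q^{n^2/2}$. $A_1^{N/2}$ denotes $\mathbb{Z}^{N/2}$ with the standard form, $D_n=\{x\in\mathbb{Z}^n:\sum x_i\text{ even}\}$ and $D_n^*$ its dual in $\mathbb{R}^n$; $\theta_M(q)=\sum_{\lambda\in M}q^{\langle\lambda,\lambda\rangle/2}$. -}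

module Defs where

open import Data.Nat using (ℕ; zero; suc; _+_; _*_; _∸_)
open import Data.List using (List; _++_; map; filter; length; upTo)
open import Data.Nat.ListAction using (sum)
import Data.Integer as ℤ
open import Data.Integer using (ℤ; +_; -[1+_])
open import Relation.Binary.PropositionalEquality using (_≡_)

-- All series below are written in the variable
-- r = q^(1/4), so that ϑ₂(q²) = Σ_n q^((n+1/2)²) = Σ_n r^((2n+1)²)
-- has integer exponents; the coefficient of q^m is the coefficient of r^(4m).
Series : Set
Series = ℕ → ℕ

intsUpTo : ℕ → List ℤ
intsUpTo b = map +_ (upTo (suc b)) ++ map -[1+_] (upTo b)

-- number of integers n (with |n| ≤ e, which contains all solutions) with f n ≡ + e
countInts : (ℤ → ℤ) → ℕ → ℕ
countInts f e = length (filter (λ n → f n ℤ.≟ + e) (intsUpTo e))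

theta3q2 : Series
theta3q2 = countInts (λ n → + 4 ℤ.* (n ℤ.* n))

theta2q2 : Series
theta2q2 = countInts (λ n → (+ 2 ℤ.* n ℤ.+ + 1) ℤ.* (+ 2 ℤ.* n ℤ.+ + 1))

_⋆_ : Series → Series → Series
(f ⋆ g) e = sum (map (λ i → f i * g (e ∸ i)) (upTo (suc e)))

one : Series
one zero = 1
one (suc _) = 0

_^ˢ_ : Series → ℕ → Series
f ^ˢ zero = one
f ^ˢ suc k = f ⋆ (f ^ˢ k)

_⊕_ : Series → Series → Series
(f ⊕ g) e = f e + g e

coeffq : Series → ℕ → ℕ
coeffq f m = f (4 * m)

{-# OPTIONS --safe #-}
module Submission where

-- ϑ₂(q²) only has exponents (2n+1)² ≡ 1 (mod 8) in r = q^(1/4), so ϑ₂(q²)^k lives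
-- on exponents ≡ k (mod 8).  The coefficient of q^j is that of r^(4j), and 4j is
-- ≡ 0 (mod 8) for even j and ≡ 4 for odd j, while N/2 ≡ 4 or 0 (mod 8) according
-- as N ≡ 8 or 0 (mod 16); so in each case ϑ₂(q²)^(N/2) contributes nothing.

open import Defs
open import Data.Nat using (ℕ; zero; suc; _*_; _+_; _∸_; _≤_; _<_; _/_; _%_; _≟_; NonZero; s≤s⁻¹)
open import Data.Nat.Divisibility using (_∣_)
open import Data.Nat.DivMod using (%-distribˡ-+; [m+kn]%n≡m%n; m*n%n≡0; m%[n*o]/o≡m/o%n)
open import Data.Nat.ListAction using (sum)
open import Data.Nat.Properties using (+-identityʳ; *-identityʳ; *-zeroʳ; m+[n∸m]≡n)
open import Data.Nat.Tactic.RingSolver as ℕ-Solver using ()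
open import Data.Integer as ℤ using (ℤ; +_; -[1+_])
open import Data.Integer.Properties as ℤ using ()
open import Data.Integer.Tactic.RingSolver as ℤ-Solver using ()
open import Data.List using (List; map; length; upTo)
open import Data.List.Properties using (filter-none)
open import Data.List.Membership.Propositional using (_∈_)
open import Data.List.Membership.Propositional.Properties using (∈-upTo⁻)
open import Data.List.Relation.Unary.All as All using (All; []; _∷_)
open import Data.Product using (_×_; _,_)
open import Relation.Binary.PropositionalEquality
  using (_≡_; _≢_; refl; sym; trans; cong; cong₂; subst; module ≡-Reasoning)
open import Relation.Nullary using (yes; no; contradiction)

sum-map-≡0 : ∀ {A : Set} (h : A → ℕ) {xs : List A} → All (λ x → h x ≡ 0) xs → sum (map h xs) ≡ 0
sum-map-≡0 h []              = refl
sum-map-≡0 h (hx≡0 ∷ hxs≡0) rewrite hx≡0 = sum-map-≡0 h hxs≡0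

SupportedOn : (d : ℕ) .{{_ : NonZero d}} → ℕ → Series → Set
SupportedOn d c f = ∀ e → e % d ≢ c % d → f e ≡ 0

module _ (d : ℕ) .{{_ : NonZero d}} where

  one-supportedOn : SupportedOn d 0 one
  one-supportedOn zero    0≢0 = contradiction refl 0≢0
  one-supportedOn (suc _) _   = refl

  %-split-∸ : ∀ {i e} → i ≤ e → e % d ≡ (i % d + (e ∸ i) % d) % d
  %-split-∸ {i} {e} i≤e = trans (cong (_% d) (sym (m+[n∸m]≡n i≤e))) (%-distribˡ-+ i (e ∸ i) d)

  ⋆-supportedOn : ∀ {a b f g} → SupportedOn d a f → SupportedOn d b g →
                  SupportedOn d (a + b) (f ⋆ g)
  ⋆-supportedOn {a} {b} {f} {g} f-supp g-supp e e≢a+b = sum-map-≡0 _ (All.tabulate term)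
    where
    term : ∀ {i} → i ∈ upTo (suc e) → f i * g (e ∸ i) ≡ 0
    term {i} i∈ with i % d ≟ a % d | (e ∸ i) % d ≟ b % d
    ... | no i≢a  | _       rewrite f-supp i i≢a = refl
    ... | yes _   | no j≢b  rewrite g-supp (e ∸ i) j≢b = *-zeroʳ (f i)
    ... | yes i≡a | yes j≡b = contradiction e≡a+b e≢a+b
      where
      open ≡-Reasoning
      e≡a+b : e % d ≡ (a + b) % d
      e≡a+b = begin
        e % d                       ≡⟨ %-split-∸ (s≤s⁻¹ (∈-upTo⁻ i∈)) ⟩
        (i % d + (e ∸ i) % d) % d   ≡⟨ cong₂ (λ u v → (u + v) % d) i≡a j≡b ⟩
        (a % d + b % d) % d         ≡⟨ %-distribˡ-+ a b d ⟨
        (a + b) % d                 ∎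

  ^ˢ-supportedOn : ∀ {a f} → SupportedOn d a f → ∀ k → SupportedOn d (k * a) (f ^ˢ k)
  ^ˢ-supportedOn f-supp zero    = one-supportedOn
  ^ˢ-supportedOn f-supp (suc k) = ⋆-supportedOn f-supp (^ˢ-supportedOn f-supp k)

  countInts-supportedOn : ∀ {c} (f : ℤ → ℤ) → (∀ n e → f n ≡ + e → e % d ≡ c % d) →
                          SupportedOn d c (countInts f)
  countInts-supportedOn f values e e≢c =
    cong length (filter-none (λ n → f n ℤ.≟ + e)
      (All.universal (λ n fn≡e → e≢c (values n e fn≡e)) (intsUpTo e)))

[2k+1]²%8≡1 : ∀ k → (2 * k + 1) * (2 * k + 1) % 8 ≡ 1
[2k+1]²%8≡1 zero    = refl
[2k+1]²%8≡1 (suc k) = begin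
  (2 * suc k + 1) * (2 * suc k + 1) % 8         ≡⟨ cong (_% 8) (step k) ⟩
  ((2 * k + 1) * (2 * k + 1) + (k + 1) * 8) % 8 ≡⟨ [m+kn]%n≡m%n ((2 * k + 1) * (2 * k + 1)) (k + 1) 8 ⟩
  (2 * k + 1) * (2 * k + 1) % 8                 ≡⟨ [2k+1]²%8≡1 k ⟩
  1                                             ∎
  where
  open ≡-Reasoning
  step : ∀ k → (2 * suc k + 1) * (2 * suc k + 1) ≡ (2 * k + 1) * (2 * k + 1) + (k + 1) * 8
  step = ℕ-Solver.solve-∀

[2n+1]² : ℤ → ℤ
[2n+1]² n = (+ 2 ℤ.* n ℤ.+ + 1) ℤ.* (+ 2 ℤ.* n ℤ.+ + 1)

[2n+1]²-pos : ∀ k → [2n+1]² (+ k) ≡ + ((2 * k + 1) * (2 * k + 1))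
[2n+1]²-pos k = sym (trans (ℤ.pos-* (2 * k + 1) (2 * k + 1)) (cong₂ ℤ._*_ 2k+1 2k+1))
  where
  2k+1 : + (2 * k + 1) ≡ + 2 ℤ.* + k ℤ.+ + 1
  2k+1 = trans (ℤ.pos-+ (2 * k) 1) (cong (ℤ._+ + 1) (ℤ.pos-* 2 k))

-- -[1+ k ] is definitionally ℤ.- (+ 1 ℤ.+ + k), which lets the solver handle it.
[2n+1]²-neg : ∀ k → [2n+1]² -[1+ k ] ≡ [2n+1]² (+ k)
[2n+1]²-neg k = reflect (+ k)
  where
  reflect : ∀ x → (+ 2 ℤ.* ℤ.- (+ 1 ℤ.+ x) ℤ.+ + 1) ℤ.* (+ 2 ℤ.* ℤ.- (+ 1 ℤ.+ x) ℤ.+ + 1)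
                ≡ (+ 2 ℤ.* x ℤ.+ + 1) ℤ.* (+ 2 ℤ.* x ℤ.+ + 1)
  reflect = ℤ-Solver.solve-∀

[2n+1]²%8≡1 : ∀ n e → [2n+1]² n ≡ + e → e % 8 ≡ 1
[2n+1]²%8≡1 (+ k)      e eq = subst (λ e → e % 8 ≡ 1)
  (ℤ.+-injective (trans (sym ([2n+1]²-pos k)) eq)) ([2k+1]²%8≡1 k)
[2n+1]²%8≡1 -[1+ k ] e eq = [2n+1]²%8≡1 (+ k) e (trans (sym ([2n+1]²-neg k)) eq)

theta2q2^-supportedOn : ∀ k → SupportedOn 8 k (theta2q2 ^ˢ k)
theta2q2^-supportedOn k = subst (λ c → SupportedOn 8 c (theta2q2 ^ˢ k)) (*-identityʳ k)
  (^ˢ-supportedOn 8 (countInts-supportedOn 8 {1} [2n+1]² [2n+1]²%8≡1) k)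

coeffq-⊕-vanishingʳ : ∀ f g j → g (4 * j) ≡ 0 → coeffq f j ≡ coeffq (f ⊕ g) j
coeffq-⊕-vanishingʳ f g j g≡0 = sym (trans (cong (λ x → f (4 * j) + x) g≡0) (+-identityʳ _))

4*[2m]%8≡0 : ∀ m → 4 * (2 * m) % 8 ≡ 0
4*[2m]%8≡0 m = trans (cong (_% 8) (4*[2m]≡m*8 m)) (m*n%n≡0 m 8)
  where
  4*[2m]≡m*8 : ∀ m → 4 * (2 * m) ≡ m * 8
  4*[2m]≡m*8 = ℕ-Solver.solve-∀

4*[2m+1]%8≡4 : ∀ m → 4 * (2 * m + 1) % 8 ≡ 4
4*[2m+1]%8≡4 m = trans (cong (_% 8) (4*[2m+1]≡4+m*8 m)) ([m+kn]%n≡m%n 4 m 8)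
  where
  4*[2m+1]≡4+m*8 : ∀ m → 4 * (2 * m + 1) ≡ 4 + m * 8
  4*[2m+1]≡4+m*8 = ℕ-Solver.solve-∀

lemma7p2 : (N : ℕ) → 0 < N → 8 ∣ N →
    ((N % 16 ≡ 8 → (m : ℕ) →
        coeffq (theta3q2 ^ˢ (N / 2)) (2 * m)
          ≡ coeffq ((theta3q2 ^ˢ (N / 2)) ⊕ (theta2q2 ^ˢ (N / 2))) (2 * m))
    × (N % 16 ≡ 0 → (m : ℕ) →
        coeffq (theta3q2 ^ˢ (N / 2)) (2 * m + 1)
          ≡ coeffq ((theta3q2 ^ˢ (N / 2)) ⊕ (theta2q2 ^ˢ (N / 2))) (2 * m + 1)))
lemma7p2 N _ _ = even-coeffs , odd-coeffs
  where
  A B : Series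
  A = theta3q2 ^ˢ (N / 2)
  B = theta2q2 ^ˢ (N / 2)

  B-vanishes : ∀ j → 4 * j % 8 ≢ N / 2 % 8 → coeffq A j ≡ coeffq (A ⊕ B) j
  B-vanishes j off = coeffq-⊕-vanishingʳ A B j (theta2q2^-supportedOn (N / 2) (4 * j) off)

  N/2%8≡r/2 : ∀ {r} → N % 16 ≡ r → N / 2 % 8 ≡ r / 2
  N/2%8≡r/2 N%16≡r = trans (sym (m%[n*o]/o≡m/o%n N 8 2)) (cong (_/ 2) N%16≡r)

  even-coeffs : N % 16 ≡ 8 → ∀ m → coeffq A (2 * m) ≡ coeffq (A ⊕ B) (2 * m)
  even-coeffs N%16≡8 m = B-vanishes (2 * m) λ same →
    contradiction (trans (sym (4*[2m]%8≡0 m)) (trans same (N/2%8≡r/2 N%16≡8))) λ ()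

  odd-coeffs : N % 16 ≡ 0 → ∀ m → coeffq A (2 * m + 1) ≡ coeffq (A ⊕ B) (2 * m + 1)
  odd-coeffs N%16≡0 m = B-vanishes (2 * m + 1) λ same →
    contradiction (trans (sym (4*[2m+1]%8≡4 m)) (trans same (N/2%8≡r/2 N%16≡0))) λ ()
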